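{- Let $k,h$ be integers with $k\ge 1$ and $h\ge k+2$. Let $T^*(k,h)$ be the tree with vertex set $\{x,z\}\cup\{z_1,\dots,z_k\}\cup\{x_{(i,j)}:1\le i,j\le h-1\}\cup\{y_{(i,j)}:1\le i,j\le h-1\}$ and edge set $\{xx_{(i,j)}:1\le i,j\le h-1\}\cup\{x_{(i,j)}y_{(i,j)}:1\le i,j\le h-1\}\cup\{xz,zz_1,\dots,zz_k\}$. Then $\tau(T^*(k,h))=k$ and $\beta_p(T^*(k,h))=h$.
   Context: Two vertices $u,v$ are twins if $N(u)\setminus\{v\}=N(v)\setminus\{u\}$; twin classes are the equivalence classes of this relation and $\tau(G)$ is the maximum cardinality of a twin class. For $u$ a vertex and $S$ a vertex set, $d(u,S)=\min_{w\in S}d(u,w)$. A partition $\Pi=\{S_1,\dots,S_k\}$ of $V(G)$ is locating if the vectors $r(u|\Pi)=(d(u,S_1),\dots,d(u,S_k))$ are pairwise distinct over $u\in V(G)$; $\beta_p(G)$ is the minimum size of a locating partition. -}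

module Defs where

open import Level using (Level; _⊔_; suc)
open import Data.Nat using (ℕ; zero; _≤_; _∸_) renaming (suc to sucℕ)
open import Data.Fin using (Fin)
open import Data.Product using (Σ; ∃; _×_; _,_)
open import Data.Sum using (_⊎_)
open import Relation.Binary.PropositionalEquality using (_≡_; _≢_)
open import Function using (Injective; _⇔_)

-- A simple graph: a vertex type with an adjacency relation
-- (symmetry/irreflexivity are properties of the concrete graph below).
record Graph : Set₁ where
  field
    V   : Set
    Adj : V → V → Set

module _ (G : Graph) where
  open Graph G

  data Walk : V → V → ℕ → Set where
    here : ∀ {u} → Walk u u 0
    step : ∀ {u w v ℓ} → Adj u w → Walk w v ℓ → Walk u v (sucℕ ℓ)

  Dist : V → V → ℕ → Set
  Dist u v m = Walk u v m × (∀ ℓ → Walk u v ℓ → m ≤ ℓ)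

  Twins : V → V → Set
  Twins u v = ∀ w → w ≢ u → w ≢ v → (Adj u w ⇔ Adj v w)

  TwinClassHasCard≥ : V → ℕ → Set
  TwinClassHasCard≥ u m =
    Σ (Fin m → V) λ f → Injective _≡_ _≡_ f × (∀ i → Twins u (f i))

  TwinNumber : ℕ → Set
  TwinNumber t =
    (Σ V λ u → TwinClassHasCard≥ u t) ×
    (∀ u m → TwinClassHasCard≥ u m → m ≤ t)

  -- A partition Π = {S_1,…,S_m} represented by a class-labelling c : V → Fin m
  -- (S_i = c⁻¹(i)), all classes nonempty.
  IsPartition : ∀ {m} → (V → Fin m) → Set
  IsPartition {m} c = ∀ i → Σ V λ u → c u ≡ i

  SetDist : ∀ {k} → (V → Fin k) → V → Fin k → ℕ → Set
  SetDist c u i m =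
    (Σ V λ w → c w ≡ i × Walk u w m) ×
    (∀ w ℓ → c w ≡ i → Walk u w ℓ → m ≤ ℓ)

  IsLocating : ∀ {k} → (V → Fin k) → Set
  IsLocating c =
    IsPartition c ×
    (∀ u v → (∀ i a b → SetDist c u i a → SetDist c v i b → a ≡ b) → u ≡ v)

  PartitionDimension : ℕ → Set
  PartitionDimension p =
    (Σ (V → Fin p) IsLocating) ×
    (∀ m (c : V → Fin m) → IsLocating c → p ≤ m)

-- The tree T*(k,h). Indices 1..h-1 are represented by Fin (h ∸ 1),
-- indices 1..k by Fin k.
data TV (k h : ℕ) : Set where
  x  : TV k h
  z  : TV k h
  zv : Fin k → TV k h
  xv : Fin (h ∸ 1) → Fin (h ∸ 1) → TV k h
  yv : Fin (h ∸ 1) → Fin (h ∸ 1) → TV k h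

data TEdge (k h : ℕ) : TV k h → TV k h → Set where
  e-xx : ∀ i j → TEdge k h x (xv i j)
  e-xy : ∀ i j → TEdge k h (xv i j) (yv i j)
  e-xz : TEdge k h x z
  e-zz : ∀ i → TEdge k h z (zv i)

T* : ℕ → ℕ → Graph
T* k h = record { V = TV k h ; Adj = λ u v → TEdge k h u v ⊎ TEdge k h v u }

-- Twins.  Two distinct vertices of T* that are not both leaves z_s, z_t are
-- separated by a vertex adjacent to exactly one of them, so the only
-- nontrivial twin class is {z_1, …, z_k}.
--
-- We exhibit a partition with h classes and compute its
-- distance vectors explicitly: a function D that vanishes on each vertex's
-- own class, grows by at most one along edges and is attained by walks is the
-- distance to the classes (a "potential").  The computed vectors are distinct.
--
-- For a partition with M classes the distance vector of
-- x_(i,j) depends only on a "signature" in Fin M × Fin M which, for M ≥ 2,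
-- misses a value.  A locating partition makes the signature injective on the
-- (h-1)² vertices x_(i,j), so (h-1)² < M² and M ≥ h.  For M ≤ 1 the vertices
-- x and z already share their vector.
module Submission where

open import Defs
open import Data.Nat using (ℕ; zero; suc; _≤_; _<_; _+_; _*_; z≤n; s≤s; _≤?_)
import Data.Nat.Properties as ℕₚ
open import Data.Fin using (Fin; zero; suc; punchIn; punchOut; combine; remQuot; splitAt; _↑ˡ_; _↑ʳ_)
import Data.Fin.Properties as Finₚ
open import Data.Fin.Properties using (_≟_)
open import Data.Bool using (if_then_else_)
open import Data.Product using (Σ; ∃; _×_; _,_; proj₁; proj₂; uncurry)
open import Data.Sum using (_⊎_; inj₁; inj₂; [_,_])
open import Data.Empty using (⊥-elim)
open import Function using (_∘_; const)
open import Relation.Nullary using (¬_; Dec; does; yes; no; contradiction)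
open import Relation.Binary.PropositionalEquality
  using (_≡_; _≢_; refl; sym; trans; cong; cong₂; subst)
open import Function.Bundles using (Equivalence; mk⇔)

injectionMissingPoint⇒< : ∀ {m n} (f : Fin m → Fin n) →
  (∀ {i j} → f i ≡ f j → i ≡ j) → (q : Fin n) → (∀ i → f i ≢ q) → m < n
injectionMissingPoint⇒< {n = zero}  f _     q _    = contradiction q λ ()
injectionMissingPoint⇒< {n = suc n} f f-inj q miss =
  s≤s (Finₚ.injective⇒≤ {f = λ i → punchOut (miss′ i)} λ {i} {j} eq →
         f-inj (Finₚ.punchOut-injective (miss′ i) (miss′ j) eq))
  where
  miss′ : ∀ i → q ≢ f i
  miss′ i eq = miss i (sym eq)

squareInjectionMissingPoint⇒< : ∀ {a b} (F : Fin a × Fin a → Fin b × Fin b) →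
  (∀ {P Q} → F P ≡ F Q → P ≡ Q) → (q : Fin b × Fin b) → (∀ P → F P ≢ q) →
  a * a < b * b
squareInjectionMissingPoint⇒< {a} {b} F F-inj q miss =
  injectionMissingPoint⇒< flat flat-inj (uncurry combine q) flat-miss
  where
  encode : Fin b × Fin b → Fin (b * b)
  encode = uncurry combine

  encode-inj : ∀ {P Q} → encode P ≡ encode Q → P ≡ Q
  encode-inj {i , j} {k , l} eq =
    let i≡k , j≡l = Finₚ.combine-injective i j k l eq in cong₂ _,_ i≡k j≡l

  decode-inj : ∀ {I J : Fin (a * a)} → remQuot a I ≡ remQuot a J → I ≡ J
  decode-inj {I} {J} eq = trans (sym (Finₚ.combine-remQuot {a} a I))
    (trans (cong (uncurry combine) eq) (Finₚ.combine-remQuot {a} a J))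

  flat : Fin (a * a) → Fin (b * b)
  flat I = encode (F (remQuot a I))

  flat-inj : ∀ {I J} → flat I ≡ flat J → I ≡ J
  flat-inj eq = decode-inj (F-inj (encode-inj eq))

  flat-miss : ∀ I → flat I ≢ encode q
  flat-miss I eq = miss (remQuot a I) (encode-inj eq)

-- The profile g altered to vanish on the class o: the distance profile of a
-- vertex in class o whose other distances are given by g.
opaque
  zeroAt : ∀ {m} → Fin m → (Fin m → ℕ) → Fin m → ℕ
  zeroAt o g i = if does (i ≟ o) then 0 else g i

  -- Reasoning principle (the only way zeroAt is unfolded): to prove
  -- P (zeroAt o g i), prove P 0 when i ≡ o and P (g i) otherwise.
  zeroAt-elim : ∀ {m} {o i : Fin m} {g : Fin m → ℕ} (P : ℕ → Set) →
    (i ≡ o → P 0) → (i ≢ o → P (g i)) → P (zeroAt o g i)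
  zeroAt-elim {o = o} {i} {g} P on off = decide (i ≟ o)
    where
    decide : (d : Dec (i ≡ o)) → P (if does d then 0 else g i)
    decide (yes i≡o) = on i≡o
    decide (no i≢o)  = off i≢o

module _ {m} {o : Fin m} {g : Fin m → ℕ} where
  zeroAt-on : zeroAt o g o ≡ 0
  zeroAt-on = zeroAt-elim (_≡ 0) (λ _ → refl) (λ o≢o → contradiction refl o≢o)

  zeroAt-off : ∀ {i} → i ≢ o → zeroAt o g i ≡ g i
  zeroAt-off {i} i≢o = zeroAt-elim (_≡ g i) (λ i≡o → contradiction i≡o i≢o) (λ _ → refl)

  zeroAt-≤ : ∀ {i} → zeroAt o g i ≤ g i
  zeroAt-≤ {i} = zeroAt-elim (_≤ g i) (λ _ → z≤n) (λ _ → ℕₚ.≤-refl)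

  zeroAt-vanishes : ∀ {i} → zeroAt o g i ≡ 0 → g i ≢ 0 → i ≡ o
  zeroAt-vanishes {i} = zeroAt-elim (λ d → d ≡ 0 → g i ≢ 0 → i ≡ o)
    (λ i≡o _ _ → i≡o) (λ _ gi≡0 gi≢0 → contradiction gi≡0 gi≢0)

-- Stepping back along a pendant edge: if f is at most 1 on o, then
-- f ≤ 1 + zeroAt o (suc ∘ f) everywhere.
zeroAt-back : ∀ {m} {o : Fin m} {f : Fin m → ℕ} →
  f o ≤ 1 → ∀ i → f i ≤ suc (zeroAt o (suc ∘ f) i)
zeroAt-back {f = f} fo≤1 i = zeroAt-elim (λ d → f i ≤ suc d)
  (λ { refl → fo≤1 }) (λ _ → ℕₚ.m≤n⇒m≤1+n (ℕₚ.n≤1+n (f i)))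

pinnedOffBase : ∀ {m} (a b b′ : Fin m) →
  (∀ e → e ≢ a → e ≡ b → e ≡ b′) → (∀ e → e ≢ a → e ≡ b′ → e ≡ b) → b ≡ b′
pinnedOffBase a b b′ to from with b ≟ a | b′ ≟ a
... | no b≢a   | _         = to b b≢a refl
... | yes _    | no b′≢a   = sym (from b′ b′≢a refl)
... | yes b≡a  | yes b′≡a  = trans b≡a (sym b′≡a)

merge : ∀ {m} (p A B : Fin m) → Fin m
merge p A B with B ≟ p
... | yes _ = A
... | no _  = B

merge-determines : ∀ {m} {p A B B′ : Fin m} →
  merge p A B ≡ merge p A B′ → B′ ≡ A ⊎ B′ ≡ B ⊎ B′ ≡ p
merge-determines {p = p} {A} {B} {B′} eq with B ≟ p | B′ ≟ p
... | _        | yes B′≡p = inj₂ (inj₂ B′≡p)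
... | yes _    | no _     = inj₁ (sym eq)
... | no _     | no _     = inj₂ (inj₁ (sym eq))

merge-hits-p : ∀ {m} {p A B : Fin m} → merge p A B ≡ p → A ≡ p
merge-hits-p {p = p} {A} {B} eq with B ≟ p
... | yes _   = eq
... | no B≢p  = contradiction eq B≢p

module GraphFacts (G : Graph) where
  open Graph G

  twinsSym : ∀ {u v} → Twins G u v → Twins G v u
  twinsSym tw w w≢v w≢u = mk⇔ (Equivalence.from (tw w w≢u w≢v)) (Equivalence.to (tw w w≢u w≢v))

  twinAdj : ∀ {u v} → Twins G u v → ∀ w → w ≢ u → w ≢ v → Adj u w → Adj v w
  twinAdj tw w w≢u w≢v = Equivalence.to (tw w w≢u w≢v)

  separated : ∀ {A : Set} {u v} → Twins G u v →
    ∀ w → w ≢ u → w ≢ v → Adj u w → ¬ Adj v w → A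
  separated tw w w≢u w≢v uw ¬vw = ⊥-elim (¬vw (twinAdj tw w w≢u w≢v uw))

  twinClassBound : ∀ {k u m} (e : Fin k → V) →
    (∀ v → Twins G u v → ∃ λ s → v ≡ e s) → TwinClassHasCard≥ G u m → m ≤ k
  twinClassBound {k} {u} {m} e cover (f , f-inj , twin) =
    Finₚ.injective⇒≤ {f = index} λ {i} {j} eq →
      f-inj (trans (named i) (trans (cong e eq) (sym (named j))))
    where
    index : Fin m → Fin k
    index i = proj₁ (cover (f i) (twin i))
    named : ∀ i → f i ≡ e (index i)
    named i = proj₂ (cover (f i) (twin i))

  Reaches : ∀ {m} → (V → Fin m) → V → Fin m → ℕ → Set
  Reaches c u i d = Σ V λ w → c w ≡ i × Walk G u w d

  extend : ∀ {m} {c : V → Fin m} {u w i d} → Adj u w → Reaches c w i d → Reaches c u i (suc d)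
  extend uw (y , cy , walk) = y , cy , step uw walk

  walkZero : ∀ {u w} → Walk G u w 0 → u ≡ w
  walkZero here = refl

  -- A potential for the labelling c: a function D vanishing on each vertex's
  -- own class, growing by at most one along edges and attained by walks.
  -- Such a D is exactly the distance d(u, S_i).
  record Potential {m} (c : V → Fin m) (D : V → Fin m → ℕ) : Set where
    field
      ownClass  : ∀ u → D u (c u) ≡ 0
      lipschitz : ∀ {u w} → Adj u w → ∀ i → D u i ≤ suc (D w i)
      attained  : ∀ u i → Reaches c u i (D u i)

    walkBound : ∀ {u w ℓ} → Walk G u w ℓ → D u (c w) ≤ ℓ
    walkBound {u} here = ℕₚ.≤-reflexive (ownClass u)
    walkBound (step uw walk) = ℕₚ.≤-trans (lipschitz uw _) (s≤s (walkBound walk))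

    setDist : ∀ u i → SetDist G c u i (D u i)
    setDist u i = attained u i , λ { w ℓ refl walk → walkBound walk }

    sameClass : ∀ {u v} → (∀ i → D u i ≡ D v i) → c u ≡ c v
    sameClass {u} {v} same with attained v (c u)
    ... | w , cw , walk rewrite sym (same (c u)) | ownClass u =
      trans (sym cw) (cong c (sym (walkZero walk)))

    locating : IsPartition G c → (∀ u v → (∀ i → D u i ≡ D v i) → u ≡ v) → IsLocating G c
    locating partition separates =
      partition , λ u v sameDist → separates u v λ i → sameDist i _ _ (setDist u i) (setDist v i)

  singleClassNotLocating : (c : V → Fin 1) → ∀ {u v} → u ≢ v → ¬ IsLocating G c
  singleClassNotLocating c {u} {v} u≢v (_ , separates) =
    u≢v (separates u v λ i a b (_ , below-a) (_ , below-b) →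
      trans (ℕₚ.n≤0⇒n≡0 (below-a u 0 (onlyClass (c u) i) here))
            (sym (ℕₚ.n≤0⇒n≡0 (below-b v 0 (onlyClass (c v) i) here))))
    where
    onlyClass : (i j : Fin 1) → i ≡ j
    onlyClass zero zero = refl

-- Twins in T*(k, h) for k ≥ 1 and h ≥ 2 (so that some x_(i,j) and z_1 exist):
-- the only nontrivial twin class is the set of leaves z_1, …, z_k at z.
module TwinsOfT* (k₀ n₀ : ℕ) where
  k : ℕ
  k = suc k₀

  G : Graph
  G = T* k (suc (suc n₀))

  open Graph G
  open GraphFacts G

  data Leaf : V → Set where
    leaf : ∀ t → Leaf (zv t)

  -- All leaves have the single neighbour z, so they are pairwise twins.
  leavesAreTwins : ∀ s t → Twins G (zv s) (zv t)
  leavesAreTwins s t w _ _ = mk⇔ toOther toOther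
    where
    toOther : ∀ {t₁ t₂} → Adj (zv t₁) w → Adj (zv t₂) w
    toOther (inj₂ (e-zz _)) = inj₂ (e-zz _)

  -- Any two distinct vertices that are not both leaves are separated by a
  -- vertex adjacent to exactly one of them.
  twinsOf : ∀ u v → Twins G u v → v ≡ u ⊎ (Leaf u × Leaf v)
  twinsOf x        x          _  = inj₁ refl
  twinsOf x        z          tw =
    separated tw (xv zero zero) (λ ()) (λ ()) (inj₁ (e-xx _ _)) λ { (inj₁ ()) ; (inj₂ ()) }
  twinsOf x        (zv t)     tw =
    separated tw (xv zero zero) (λ ()) (λ ()) (inj₁ (e-xx _ _)) λ { (inj₁ ()) ; (inj₂ ()) }
  twinsOf x        (xv a b)   tw =
    separated tw z (λ ()) (λ ()) (inj₁ e-xz) λ { (inj₁ ()) ; (inj₂ ()) }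
  twinsOf x        (yv a b)   tw =
    separated tw z (λ ()) (λ ()) (inj₁ e-xz) λ { (inj₁ ()) ; (inj₂ ()) }
  twinsOf z        x          tw =
    separated (twinsSym tw) (xv zero zero) (λ ()) (λ ()) (inj₁ (e-xx _ _)) λ { (inj₁ ()) ; (inj₂ ()) }
  twinsOf z        z          _  = inj₁ refl
  twinsOf z        (zv t)     tw =
    separated tw x (λ ()) (λ ()) (inj₂ e-xz) λ { (inj₁ ()) ; (inj₂ ()) }
  twinsOf z        (xv a b)   tw =
    separated tw (zv zero) (λ ()) (λ ()) (inj₁ (e-zz _)) λ { (inj₁ ()) ; (inj₂ ()) }
  twinsOf z        (yv a b)   tw =
    separated tw x (λ ()) (λ ()) (inj₂ e-xz) λ { (inj₁ ()) ; (inj₂ ()) }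
  twinsOf (zv t)   x          tw =
    separated (twinsSym tw) (xv zero zero) (λ ()) (λ ()) (inj₁ (e-xx _ _)) λ { (inj₁ ()) ; (inj₂ ()) }
  twinsOf (zv t)   z          tw =
    separated (twinsSym tw) x (λ ()) (λ ()) (inj₂ e-xz) λ { (inj₁ ()) ; (inj₂ ()) }
  twinsOf (zv s)   (zv t)     _  = inj₂ (leaf s , leaf t)
  twinsOf (zv t)   (xv a b)   tw =
    separated tw z (λ ()) (λ ()) (inj₂ (e-zz t)) λ { (inj₁ ()) ; (inj₂ ()) }
  twinsOf (zv t)   (yv a b)   tw =
    separated tw z (λ ()) (λ ()) (inj₂ (e-zz t)) λ { (inj₁ ()) ; (inj₂ ()) }
  twinsOf (xv a b) x          tw =
    separated (twinsSym tw) z (λ ()) (λ ()) (inj₁ e-xz) λ { (inj₁ ()) ; (inj₂ ()) }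
  twinsOf (xv a b) z          tw =
    separated (twinsSym tw) (zv zero) (λ ()) (λ ()) (inj₁ (e-zz _)) λ { (inj₁ ()) ; (inj₂ ()) }
  twinsOf (xv a b) (zv t)     tw =
    separated (twinsSym tw) z (λ ()) (λ ()) (inj₂ (e-zz t)) λ { (inj₁ ()) ; (inj₂ ()) }
  twinsOf (xv a b) (xv _ _)   tw with twinAdj tw (yv a b) (λ ()) (λ ()) (inj₁ (e-xy a b))
  ... | inj₁ (e-xy _ _) = inj₁ refl
  twinsOf (xv a b) (yv _ _)   tw =
    separated tw x (λ ()) (λ ()) (inj₂ (e-xx a b)) λ { (inj₁ ()) ; (inj₂ ()) }
  twinsOf (yv a b) x          tw =
    separated (twinsSym tw) z (λ ()) (λ ()) (inj₁ e-xz) λ { (inj₁ ()) ; (inj₂ ()) }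
  twinsOf (yv a b) z          tw =
    separated (twinsSym tw) x (λ ()) (λ ()) (inj₂ e-xz) λ { (inj₁ ()) ; (inj₂ ()) }
  twinsOf (yv a b) (zv t)     tw =
    separated (twinsSym tw) z (λ ()) (λ ()) (inj₂ (e-zz t)) λ { (inj₁ ()) ; (inj₂ ()) }
  twinsOf (yv a b) (xv c d)   tw =
    separated (twinsSym tw) x (λ ()) (λ ()) (inj₂ (e-xx c d)) λ { (inj₁ ()) ; (inj₂ ()) }
  twinsOf (yv a b) (yv _ _)   tw with twinAdj tw (xv a b) (λ ()) (λ ()) (inj₂ (e-xy a b))
  ... | inj₂ (e-xy _ _) = inj₁ refl

  -- A vertex that is not a leaf is its own only twin, so its class has at most 1 ≤ k elements.
  nonLeafTwinClass : ∀ u → ¬ Leaf u → ∀ m → TwinClassHasCard≥ G u m → m ≤ k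
  nonLeafTwinClass u notLeaf m card =
    ℕₚ.≤-trans (twinClassBound (λ (_ : Fin 1) → u) onlyItself card) (s≤s z≤n)
    where
    onlyItself : ∀ v → Twins G u v → ∃ λ (s : Fin 1) → v ≡ u
    onlyItself v tw with twinsOf u v tw
    ... | inj₁ v≡u          = zero , v≡u
    ... | inj₂ (leafU , _)  = ⊥-elim (notLeaf leafU)

  -- The twins of a leaf are leaves, so every twin class has at most k elements.
  twinClassesAtMostK : ∀ u m → TwinClassHasCard≥ G u m → m ≤ k
  twinClassesAtMostK (zv t)   m = twinClassBound zv λ v tw → asLeaf (twinsOf (zv t) v tw)
    where
    asLeaf : ∀ {v} → v ≡ zv t ⊎ (Leaf (zv t) × Leaf v) → ∃ λ s → v ≡ zv s
    asLeaf (inj₁ refl)         = t , refl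
    asLeaf (inj₂ (_ , leaf s)) = s , refl
  twinClassesAtMostK x        = nonLeafTwinClass x (λ ())
  twinClassesAtMostK z        = nonLeafTwinClass z (λ ())
  twinClassesAtMostK (xv a b) = nonLeafTwinClass (xv a b) (λ ())
  twinClassesAtMostK (yv a b) = nonLeafTwinClass (yv a b) (λ ())

  twinNumber : TwinNumber G k
  twinNumber = (zv zero , zv , (λ { refl → refl }) , leavesAreTwins zero) , twinClassesAtMostK

-- The upper bound β_p(T*(k, h)) ≤ h for h = k + r + 2, via the partition with
-- S_0 = {x, z} and, for each e < h - 1, S_(1+e) = {x_(e,j)} ∪ {y_(i,e)} ∪ {z_e}
-- (the leaf z_e only for e < k).  Its distance profiles are written down
-- explicitly and form a potential that separates all vertices.
module UpperBound (k r : ℕ) where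
  n : ℕ
  n = k + suc r

  G : Graph
  G = T* k (suc n)

  open Graph G
  open GraphFacts G

  -- Indices below k carry a leaf; `far` is the first index that does not.
  leafIndex : Fin k → Fin n
  leafIndex t = t ↑ˡ suc r

  far : Fin n
  far = k ↑ʳ zero

  leafIndex≢far : ∀ t → leafIndex t ≢ far
  leafIndex≢far t eq with trans (sym (Finₚ.splitAt-↑ˡ k t (suc r)))
                             (trans (cong (splitAt k) eq) (Finₚ.splitAt-↑ʳ k (suc r) zero))
  ... | ()

  c : V → Fin (suc n)
  c x        = zero
  c z        = zero
  c (zv t)   = suc (leafIndex t)
  c (xv a b) = suc a
  c (yv a b) = suc b

  -- Distance profiles.  x is adjacent to x_(e,e) ∈ S_(1+e); z reaches S_(1+e)
  -- through a leaf when e < k and through x otherwise; x_(a,b) reaches all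
  -- classes through y_(a,b) or x, and the leaves y_(a,b), z_t through their
  -- unique neighbour.
  Dx : Fin (suc n) → ℕ
  Dx zero    = 0
  Dx (suc e) = 1

  Dz : Fin (suc n) → ℕ
  Dz zero    = 0
  Dz (suc e) = [ const 1 , const 2 ] (splitAt k e)

  Dxv : Fin n → Fin n → Fin (suc n) → ℕ
  Dxv a b = zeroAt (suc a) (suc ∘ zeroAt (suc b) Dx)

  D : V → Fin (suc n) → ℕ
  D x        = Dx
  D z        = Dz
  D (zv t)   = zeroAt (suc (leafIndex t)) (suc ∘ Dz)
  D (xv a b) = Dxv a b
  D (yv a b) = zeroAt (suc b) (suc ∘ Dxv a b)

  Dx≤1 : ∀ i → Dx i ≤ 1
  Dx≤1 zero    = z≤n
  Dx≤1 (suc e) = ℕₚ.≤-refl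

  Dz≤1+Dx : ∀ i → Dz i ≤ suc (Dx i)
  Dz≤1+Dx zero    = z≤n
  Dz≤1+Dx (suc e) with splitAt k e
  ... | inj₁ _ = s≤s z≤n
  ... | inj₂ _ = ℕₚ.≤-refl

  Dz-leaf : ∀ t → Dz (suc (leafIndex t)) ≡ 1
  Dz-leaf t rewrite Finₚ.splitAt-↑ˡ k t (suc r) = refl

  Dz-far : Dz (suc far) ≡ 2
  Dz-far rewrite Finₚ.splitAt-↑ʳ k (suc r) zero = refl

  Dxv≤1+Dx : ∀ a b i → Dxv a b i ≤ suc (Dx i)
  Dxv≤1+Dx a b i = ℕₚ.≤-trans zeroAt-≤ (s≤s zeroAt-≤)

  Dxv-column : ∀ a b → Dxv a b (suc b) ≤ 1
  Dxv-column a b = ℕₚ.≤-trans zeroAt-≤ (s≤s (ℕₚ.≤-reflexive zeroAt-on))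

  ownClass : ∀ u → D u (c u) ≡ 0
  ownClass x        = refl
  ownClass z        = refl
  ownClass (zv t)   = zeroAt-on
  ownClass (xv a b) = zeroAt-on
  ownClass (yv a b) = zeroAt-on

  lipschitz : ∀ {u w} → Adj u w → ∀ i → D u i ≤ suc (D w i)
  lipschitz (inj₁ (e-xx a b)) i = ℕₚ.≤-trans (Dx≤1 i) (s≤s z≤n)
  lipschitz (inj₂ (e-xx a b)) i = Dxv≤1+Dx a b i
  lipschitz (inj₁ (e-xy a b)) i = zeroAt-back (Dxv-column a b) i
  lipschitz (inj₂ (e-xy a b)) i = zeroAt-≤
  lipschitz (inj₁ e-xz)       i = ℕₚ.≤-trans (Dx≤1 i) (s≤s z≤n)
  lipschitz (inj₂ e-xz)       i = Dz≤1+Dx i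
  lipschitz (inj₁ (e-zz t))   i = zeroAt-back (ℕₚ.≤-reflexive (Dz-leaf t)) i
  lipschitz (inj₂ (e-zz t))   i = zeroAt-≤

  reachX : ∀ i → Reaches c x i (Dx i)
  reachX zero    = x , refl , here
  reachX (suc e) = xv e e , refl , step (inj₁ (e-xx e e)) here

  reachZ : ∀ i → Reaches c z i (Dz i)
  reachZ zero = z , refl , here
  reachZ (suc e) with splitAt k e in leafSplit
  ... | inj₁ t = zv t , cong suc (Finₚ.splitAt⁻¹-↑ˡ leafSplit) , step (inj₁ (e-zz t)) here
  ... | inj₂ _ = extend (inj₂ e-xz) (reachX (suc e))

  reachXv : ∀ a b i → Reaches c (xv a b) i (Dxv a b i)
  reachXv a b i = zeroAt-elim (Reaches c (xv a b) i)
    (λ { refl → xv a b , refl , here })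
    (λ _ → zeroAt-elim (λ d → Reaches c (xv a b) i (suc d))
      (λ { refl → yv a b , refl , step (inj₁ (e-xy a b)) here })
      (λ _ → extend (inj₂ (e-xx a b)) (reachX i)))

  attained : ∀ u i → Reaches c u i (D u i)
  attained x        = reachX
  attained z        = reachZ
  attained (zv t) i = zeroAt-elim (Reaches c (zv t) i)
    (λ { refl → zv t , refl , here })
    (λ _ → extend (inj₂ (e-zz t)) (reachZ i))
  attained (xv a b) = reachXv a b
  attained (yv a b) i = zeroAt-elim (Reaches c (yv a b) i)
    (λ { refl → yv a b , refl , here })
    (λ _ → extend (inj₂ (e-xy a b)) (reachXv a b i))

  potential : Potential c D
  potential = record { ownClass = ownClass ; lipschitz = lipschitz ; attained = attained }

  open Potential potential using (sameClass; locating)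

  -- The distance to S_0 = {x, z} is the depth below the hub x.
  depth : V → ℕ
  depth x        = 0
  depth z        = 0
  depth (zv t)   = 1
  depth (xv a b) = 1
  depth (yv a b) = 2

  Dxv-hub : ∀ a b → Dxv a b zero ≡ 1
  Dxv-hub a b = trans (zeroAt-off λ ()) (cong suc (zeroAt-off λ ()))

  hubDistance : ∀ u → D u zero ≡ depth u
  hubDistance x        = refl
  hubDistance z        = refl
  hubDistance (zv t)   = zeroAt-off λ ()
  hubDistance (xv a b) = Dxv-hub a b
  hubDistance (yv a b) = trans (zeroAt-off λ ()) (cong suc (Dxv-hub a b))

  -- In the class S_(1+far), which holds no leaf, z_t is at distance 3 while
  -- every x_(a,b) is within distance 2.
  Dzv-far : ∀ t → D (zv t) (suc far) ≡ 3
  Dzv-far t = trans (zeroAt-off (leafIndex≢far t ∘ sym ∘ Finₚ.suc-injective)) (cong suc Dz-far)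

  leafFar≢rowFar : ∀ t a b → D (zv t) (suc far) ≢ Dxv a b (suc far)
  leafFar≢rowFar t a b eq =
    ℕₚ.≤⇒≯ (Dxv≤1+Dx a b (suc far)) (subst (2 <_) (trans (sym (Dzv-far t)) eq) ℕₚ.≤-refl)

  -- Off its own row a, x_(a,b) is at distance 1 exactly from the class of its
  -- column b; symmetrically for y_(a,b) with rows and columns exchanged.
  xvColumn : ∀ {a b e} → e ≢ a → Dxv a b (suc e) ≡ 1 → e ≡ b
  xvColumn {a} {b} {e} e≢a eq = Finₚ.suc-injective (zeroAt-vanishes viaNeighbours λ ())
    where
    viaNeighbours : zeroAt (suc b) Dx (suc e) ≡ 0
    viaNeighbours = ℕₚ.suc-injective (trans (sym (zeroAt-off (e≢a ∘ Finₚ.suc-injective))) eq)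

  xvSeesColumn : ∀ {a e} → e ≢ a → Dxv a e (suc e) ≡ 1
  xvSeesColumn e≢a = trans (zeroAt-off (e≢a ∘ Finₚ.suc-injective)) (cong suc zeroAt-on)

  yvRow : ∀ {a b e} → e ≢ b → D (yv a b) (suc e) ≡ 1 → e ≡ a
  yvRow {a} {b} {e} e≢b eq = Finₚ.suc-injective (zeroAt-vanishes viaNeighbour λ ())
    where
    viaNeighbour : Dxv a b (suc e) ≡ 0
    viaNeighbour = ℕₚ.suc-injective (trans (sym (zeroAt-off (e≢b ∘ Finₚ.suc-injective))) eq)

  yvSeesRow : ∀ {b e} → e ≢ b → D (yv e b) (suc e) ≡ 1
  yvSeesRow e≢b = trans (zeroAt-off (e≢b ∘ Finₚ.suc-injective)) (cong suc zeroAt-on)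

  SameProfile : V → V → Set
  SameProfile u v = ∀ i → D u i ≡ D v i

  sameDepth : ∀ u v → SameProfile u v → depth u ≡ depth v
  sameDepth u v same = trans (sym (hubDistance u)) (trans (same zero) (hubDistance v))

  -- Vertices of equal depth are told apart by S_(1+far) (x versus z, z_t
  -- versus x_(a,b)), by their class (z_t versus z_t′), or by the column/row
  -- of x_(a,b) / y_(a,b) within their common class.
  separate : ∀ u v → SameProfile u v → depth u ≡ depth v → u ≡ v
  separate x        x          _    _ = refl
  separate x        z          same _ = contradiction (trans (same (suc far)) Dz-far) λ ()
  separate z        x          same _ = contradiction (trans (sym (same (suc far))) Dz-far) λ ()
  separate z        z          _    _ = refl
  separate (zv t)   (zv t′)    same _ =
    cong zv (Finₚ.↑ˡ-injective (suc r) t t′ (Finₚ.suc-injective (sameClass {zv t} {zv t′} same)))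
  separate (zv t)   (xv a b)   same _ = contradiction (same (suc far)) (leafFar≢rowFar t a b)
  separate (xv a b) (zv t)     same _ = contradiction (sym (same (suc far))) (leafFar≢rowFar t a b)
  separate (xv a b) (xv a′ b′) same _ with Finₚ.suc-injective (sameClass {xv a b} {xv a′ b′} same)
  ... | refl = cong (xv a) (pinnedOffBase a b b′
    (λ { e e≢a refl → xvColumn e≢a (trans (sym (same (suc e))) (xvSeesColumn e≢a)) })
    (λ { e e≢a refl → xvColumn e≢a (trans (same (suc e)) (xvSeesColumn e≢a)) }))
  separate (yv a b) (yv a′ b′) same _ with Finₚ.suc-injective (sameClass {yv a b} {yv a′ b′} same)
  ... | refl = cong (λ a → yv a b) (pinnedOffBase b a a′
    (λ { e e≢b refl → yvRow e≢b (trans (sym (same (suc e))) (yvSeesRow e≢b)) })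
    (λ { e e≢b refl → yvRow e≢b (trans (same (suc e)) (yvSeesRow e≢b)) }))
  separate x        (zv _)     _ ()
  separate x        (xv _ _)   _ ()
  separate x        (yv _ _)   _ ()
  separate z        (zv _)     _ ()
  separate z        (xv _ _)   _ ()
  separate z        (yv _ _)   _ ()
  separate (zv _)   x          _ ()
  separate (zv _)   z          _ ()
  separate (zv _)   (yv _ _)   _ ()
  separate (xv _ _) x          _ ()
  separate (xv _ _) z          _ ()
  separate (xv _ _) (yv _ _)   _ ()
  separate (yv _ _) x          _ ()
  separate (yv _ _) z          _ ()
  separate (yv _ _) (zv _)     _ ()
  separate (yv _ _) (xv _ _)   _ ()

  profilesSeparate : ∀ u v → SameProfile u v → u ≡ v
  profilesSeparate u v same = separate u v same (sameDepth u v same)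

  partition : IsPartition G c
  partition zero    = x , refl
  partition (suc e) = xv e e , refl

  locatingPartition : Σ (V → Fin (suc n)) (IsLocating G)
  locatingPartition = c , locating partition profilesSeparate

-- The lower bound β_p(T*(k, n+1)) ≥ n + 1.  In a partition with M classes,
-- the distance vector of x_(a,b) depends only on the class A of x_(a,b) and on
-- merge (class of x) A (class of y_(a,b)).  For M ≥ 2 these pairs miss a
-- value, so locating forces n² < M², i.e. M > n; for M ≤ 1 already x and z
-- are not told apart.
module LowerBound (k n : ℕ) where
  G : Graph
  G = T* k (suc n)

  open Graph G
  open GraphFacts G

  -- A walk from x_(a,b) stays on the pendant path x_(a,b) – y_(a,b) or leaves
  -- it through the hub x.
  data PathExit (a b : Fin n) : V → ℕ → Set where
    atStart : ∀ {ℓ} → PathExit a b (xv a b) ℓ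
    atLeaf  : ∀ {ℓ} → 1 ≤ ℓ → PathExit a b (yv a b) ℓ
    viaHub  : ∀ {w l ℓ} → suc l ≤ ℓ → Walk G x w l → PathExit a b w ℓ

  lengthen : ∀ {a b w ℓ ℓ′} → ℓ ≤ ℓ′ → PathExit a b w ℓ → PathExit a b w ℓ′
  lengthen _     atStart              = atStart
  lengthen ℓ≤ℓ′ (atLeaf 1≤ℓ)          = atLeaf (ℕₚ.≤-trans 1≤ℓ ℓ≤ℓ′)
  lengthen ℓ≤ℓ′ (viaHub l<ℓ hubWalk)  = viaHub (ℕₚ.≤-trans l<ℓ ℓ≤ℓ′) hubWalk

  exitFromXv : ∀ {a b w ℓ} → Walk G (xv a b) w ℓ → PathExit a b w ℓ
  exitFromYv : ∀ {a b w ℓ} → Walk G (yv a b) w ℓ → PathExit a b w (suc ℓ)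

  exitFromXv here                          = atStart
  exitFromXv (step (inj₁ (e-xy _ _)) walk) = exitFromYv walk
  exitFromXv (step (inj₂ (e-xx _ _)) walk) = viaHub ℕₚ.≤-refl walk

  exitFromYv here                          = atLeaf (s≤s z≤n)
  exitFromYv (step (inj₂ (e-xy _ _)) walk) =
    lengthen (ℕₚ.m≤n⇒m≤1+n (ℕₚ.n≤1+n _)) (exitFromXv walk)

  module _ {M} (c : V → Fin M) where
    -- x_(a,b) is at distance at most 1 from the classes in Near a b.
    Near : Fin n → Fin n → Fin M → Set
    Near a b j = j ≡ c (xv a b) ⊎ j ≡ c (yv a b) ⊎ j ≡ c x

    dominated : ∀ {a b a′ b′ i d d′} →
      c (xv a b) ≡ c (xv a′ b′) → Near a b (c (yv a′ b′)) →
      SetDist G c (xv a b) i d → SetDist G c (xv a′ b′) i d′ → d ≤ d′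
    dominated {a} {b} {d = d} sameRow near (_ , below) ((w , cw , walk) , _) with exitFromXv walk
    ... | atStart            = ℕₚ.≤-trans (below (xv a b) 0 (trans sameRow cw) here) z≤n
    ... | viaHub l<ℓ hubWalk = ℕₚ.≤-trans (below w _ cw (step (inj₂ (e-xx a b)) hubWalk)) l<ℓ
    ... | atLeaf 1≤ℓ         = ℕₚ.≤-trans (withinOne near) 1≤ℓ
      where
      withinOne : Near a b (c w) → d ≤ 1
      withinOne (inj₁ e)        = ℕₚ.≤-trans (below (xv a b) 0 (trans (sym e) cw) here) z≤n
      withinOne (inj₂ (inj₁ e)) = below (yv a b) 1 (trans (sym e) cw) (step (inj₁ (e-xy a b)) here)
      withinOne (inj₂ (inj₂ e)) = below x 1 (trans (sym e) cw) (step (inj₂ (e-xx a b)) here)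

    -- What the distance vector of x_(a,b) can depend on.
    signature : Fin n × Fin n → Fin M × Fin M
    signature (a , b) = c (xv a b) , merge (c x) (c (xv a b)) (c (yv a b))

    sameSignature⇒sameDistances : ∀ {a b a′ b′} → signature (a , b) ≡ signature (a′ , b′) →
      ∀ i d d′ → SetDist G c (xv a b) i d → SetDist G c (xv a′ b′) i d′ → d ≡ d′
    sameSignature⇒sameDistances {a} {b} {a′} {b′} eq i d d′ dist dist′ =
      ℕₚ.≤-antisym (dominated sameRow (merge-determines merged) dist dist′)
                   (dominated (sym sameRow) (merge-determines merged′) dist′ dist)
      where
      sameRow : c (xv a b) ≡ c (xv a′ b′)
      sameRow = cong proj₁ eq
      merged : merge (c x) (c (xv a b)) (c (yv a b))
             ≡ merge (c x) (c (xv a b)) (c (yv a′ b′))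
      merged = trans (cong proj₂ eq) (cong (λ A → merge (c x) A (c (yv a′ b′))) (sym sameRow))
      merged′ : merge (c x) (c (xv a′ b′)) (c (yv a′ b′))
              ≡ merge (c x) (c (xv a′ b′)) (c (yv a b))
      merged′ = trans (sym (cong proj₂ eq)) (cong (λ A → merge (c x) A (c (yv a b))) sameRow)

    signature-injective : IsLocating G c → ∀ {P Q} → signature P ≡ signature Q → P ≡ Q
    signature-injective (_ , separates) {a , b} {a′ , b′} eq
      with separates (xv a b) (xv a′ b′) (sameSignature⇒sameDistances eq)
    ... | refl = refl

    signature-misses : ∀ q → q ≢ c x → ∀ P → signature P ≢ (q , c x)
    signature-misses q q≢p (a , b) eq =
      q≢p (trans (sym (cong proj₁ eq)) (merge-hits-p {B = c (yv a b)} (cong proj₂ eq)))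

  squareBound : ∀ {M} (c : V → Fin (suc (suc M))) → IsLocating G c →
    n * n < suc (suc M) * suc (suc M)
  squareBound {M} c locating =
    squareInjectionMissingPoint⇒< (signature c) (signature-injective c locating)
      (other , c x) (signature-misses c other (Finₚ.punchInᵢ≢i (c x) zero))
    where
    other : Fin (suc (suc M))
    other = punchIn (c x) zero

  -- At most n classes never suffice: no labelling by Fin 0 exists, a single
  -- class confuses x and z, and otherwise n² < M² ≤ n².
  tooFewClasses : ∀ {M} (c : V → Fin M) → M ≤ n → ¬ IsLocating G c
  tooFewClasses {zero}        c _   _        = contradiction (c x) λ ()
  tooFewClasses {suc zero}    c _            = singleClassNotLocating c {x} {z} λ ()
  tooFewClasses {suc (suc M)} c M≤n locating =
    ℕₚ.<⇒≱ (squareBound c locating) (ℕₚ.*-mono-≤ M≤n M≤n)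

  lowerBound : ∀ M (c : V → Fin M) → IsLocating G c → suc n ≤ M
  lowerBound M c locating with M ≤? n
  ... | yes M≤n = contradiction locating (tooFewClasses c M≤n)
  ... | no M≰n  = ℕₚ.≰⇒> M≰n

mainTheorem4 : (k h : ℕ) → 1 ≤ k → k + 2 ≤ h →
    TwinNumber (T* k h) k × PartitionDimension (T* k h) h
mainTheorem4 zero       h () _
mainTheorem4 k@(suc k₀) h _ k+2≤h = subst Claim h′≡h
  ( TwinsOfT*.twinNumber k₀ (k₀ + suc r)
  , UpperBound.locatingPartition k r
  , LowerBound.lowerBound k (k + suc r) )
  where
  Claim : ℕ → Set
  Claim m = TwinNumber (T* k m) k × PartitionDimension (T* k m) m

  -- Write h = (k + 2) + r; the three parts are stated for h = suc (k + suc r).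
  r : ℕ
  r = proj₁ (ℕₚ.m≤n⇒∃[o]m+o≡n k+2≤h)

  h′≡h : suc (k + suc r) ≡ h
  h′≡h = trans (sym (ℕₚ.+-suc k (suc r)))
               (trans (sym (ℕₚ.+-assoc k 2 r)) (proj₂ (ℕₚ.m≤n⇒∃[o]m+o≡n k+2≤h)))
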